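{- Let $G$ be a partial cube and let $F_1$ and $F_2$ be $\Theta$-classes of $G$. Then $F_1 \cup F_2$ is an edge general position set of $G$.
   Context: All graphs are finite, simple and connected; $d_G$ denotes the shortest-path distance. A graph $G$ is a partial cube if it is isomorphic to an isometric subgraph of some hypercube (i.e. a subgraph $H$ with $d_H(x,y)=d_{Q_r}(x,y)$ for all its vertices $x,y$). The Djoković–Winkler relation $\Theta$ on $E(G)$ is defined by: edges $xy$ and $uv$ are in relation $\Theta$ if $d_G(x,u) + d_G(y,v) \neq d_G(x,v) + d_G(y,u)$. In a partial cube $\Theta$ is an equivalence relation, and its equivalence classes are called $\Theta$-classes. A geodesic is a shortest path. A set $S$ of edges of $G$ is an edge general position set if no geodesic of $G$ contains three edges of $S$. -}

module Defs where

open import Data.Nat using (ℕ; zero; suc; _+_; _≤_; _<_)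
open import Data.Fin using (Fin; inject₁; fromℕ; toℕ) renaming (zero to fzero; suc to fsuc)
open import Data.Bool using (Bool; true; false; _≟_)
open import Data.Product using (Σ; ∃; _×_; _,_)
open import Data.Sum using (_⊎_)
open import Relation.Binary.PropositionalEquality using (_≡_)
open import Relation.Nullary using (¬_; does)

record Graph (n : ℕ) : Set₁ where
  field
    Adj     : Fin n → Fin n → Set
    sym     : ∀ {x y} → Adj x y → Adj y x
    irrefl  : ∀ {x} → ¬ Adj x x

module _ {n : ℕ} (G : Graph n) where
  open Graph G

  record Walk : Set where
    field
      len   : ℕ
      vtx   : Fin (suc len) → Fin n
      step  : (i : Fin len) → Adj (vtx (inject₁ i)) (vtx (fsuc i))
    start : Fin n
    start = vtx fzero
    end : Fin n
    end = vtx (fromℕ len)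
  open Walk public

  -- d is the shortest-path distance of G (this also forces G to be connected).
  IsDistance : (Fin n → Fin n → ℕ) → Set
  IsDistance d = ∀ x y →
      (Σ Walk λ w → start w ≡ x × end w ≡ y × len w ≡ d x y)
    × (∀ (w : Walk) → start w ≡ x → end w ≡ y → d x y ≤ len w)

  IsGeodesic : (Fin n → Fin n → ℕ) → Walk → Set
  IsGeodesic d w = len w ≡ d (start w) (end w)

  -- edge set: predicate on (oriented) adjacent pairs
  EdgeSet : Set₁
  EdgeSet = Fin n → Fin n → Set

  IsEdgeGeneralPosition : (Fin n → Fin n → ℕ) → EdgeSet → Set
  IsEdgeGeneralPosition d S = ∀ (w : Walk) → IsGeodesic d w →
    ∀ (i j k : Fin (len w)) → toℕ i < toℕ j → toℕ j < toℕ k →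
    ¬ ( S (vtx w (inject₁ i)) (vtx w (fsuc i))
      × S (vtx w (inject₁ j)) (vtx w (fsuc j))
      × S (vtx w (inject₁ k)) (vtx w (fsuc k)))

hamming : ∀ {r} → (Fin r → Bool) → (Fin r → Bool) → ℕ
hamming {zero}  u v = 0
hamming {suc r} u v =
  (if does (u fzero ≟ v fzero) then 0 else 1) + hamming (λ i → u (fsuc i)) (λ i → v (fsuc i))
  where open import Data.Bool using (if_then_else_)

-- G (with distance d) is a partial cube: it is isomorphic to an isometric
-- subgraph of some hypercube Q_r, i.e. there is a map into Q_r preserving distances.
IsPartialCube : ∀ {n} → (Fin n → Fin n → ℕ) → Set
IsPartialCube {n} d = Σ ℕ λ r → Σ (Fin n → (Fin r → Bool)) λ f →
  ∀ x y → hamming (f x) (f y) ≡ d x y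

Θ : ∀ {n} → (Fin n → Fin n → ℕ) → Fin n → Fin n → Fin n → Fin n → Set
Θ d x y u v = ¬ (d x u + d y v ≡ d x v + d y u)

ΘClass : ∀ {n} (G : Graph n) (d : Fin n → Fin n → ℕ) (a b : Fin n) → EdgeSet G
ΘClass G d a b u v = Graph.Adj G u v × Θ d a b u v

_∪E_ : ∀ {n} {G : Graph n} → EdgeSet G → EdgeSet G → EdgeSet G
(S ∪E T) x y = S x y ⊎ T x y

-- Through an isometric embedding into a hypercube, two edges are Θ-related exactly when their
-- images flip the same coordinate; in particular Θ is transitive on edges. Edges p < q of a
-- geodesic satisfy d(p,q) + d(p+1,q+1) = 2(q−p) = d(p,q+1) + d(p+1,q), so they are not
-- Θ-related. Hence a geodesic contains at most one edge of each Θ-class, and at most two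
-- edges of the union of two classes.

module Submission where

open import Defs
open import Data.Bool using (Bool; true; false; not; _≟_; if_then_else_)
open import Data.Bool.Properties using (¬-not)
open import Data.Empty using (⊥; ⊥-elim)
open import Data.Fin using (Fin; toℕ; inject₁; fromℕ; fromℕ<) renaming (zero to fzero; suc to fsuc)
open import Data.Fin.Properties using (toℕ<n; toℕ-fromℕ<)
open import Data.Nat using (ℕ; zero; suc; _+_; _≤_; _<_; z≤n; s≤s)
open import Data.Nat.Properties
  using ( +-comm; +-assoc; +-suc; +-identityʳ; +-cancelˡ-≡; +-cancelʳ-≡; +-cancelˡ-≤; +-cancelʳ-≤
        ; +-mono-≤; +-monoʳ-≤; ≤-antisym; ≤-reflexive; ≤-trans; <⇒≤; <-trans; m≤m+n; m≤n⇒∃[o]m+o≡n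
        ; n≤0⇒n≡0; n≢0⇒n>0; 1+n≢0; suc-injective; +-commutativeSemigroup; module ≤-Reasoning )
open import Algebra.Properties.CommutativeSemigroup +-commutativeSemigroup using (interchange)
open import Data.Product using (_,_; proj₁; proj₂)
open import Data.Sum using (_⊎_; inj₁; inj₂)
open import Data.Vec.Functional using (head; tail)
open import Function using (_∘_)
open import Relation.Binary.Definitions using (Transitive)
open import Relation.Binary.PropositionalEquality
open import Relation.Nullary using (¬_; does; yes; no)

bitDistance : Bool → Bool → ℕ
bitDistance a b = if does (a ≟ b) then 0 else 1

-- Θ d x y u v is by definition ¬ Balanced d x y u v.
Balanced : {A : Set} → (A → A → ℕ) → A → A → A → A → Set
Balanced dist x y u v = dist x u + dist y v ≡ dist x v + dist y u

balanced-resp : ∀ {A : Set} {d₁ d₂ : A → A → ℕ} → (∀ a b → d₁ a b ≡ d₂ a b) →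
                ∀ {x y u v} → Balanced d₁ x y u v → Balanced d₂ x y u v
balanced-resp d₁≡d₂ {x} {y} {u} {v} bal =
  trans (cong₂ _+_ (sym (d₁≡d₂ x u)) (sym (d₁≡d₂ y v)))
        (trans bal (cong₂ _+_ (d₁≡d₂ x v) (d₁≡d₂ y u)))

balanced-degenerateˡ : ∀ {A : Set} (dist : A → A → ℕ) {x y} → x ≡ y → ∀ u v → Balanced dist x y u v
balanced-degenerateˡ dist {x} refl u v = +-comm (dist x u) (dist x v)

balanced-degenerateʳ : ∀ {A : Set} (dist : A → A → ℕ) {u v} → u ≡ v → ∀ x y → Balanced dist x y u v
balanced-degenerateʳ _ refl _ _ = refl

unbalanced-bits : ∀ {x y u v} → y ≡ not x → v ≡ not u → ¬ Balanced bitDistance x y u v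
unbalanced-bits {false} {u = false} refl refl ()
unbalanced-bits {false} {u = true}  refl refl ()
unbalanced-bits {true}  {u = false} refl refl ()
unbalanced-bits {true}  {u = true}  refl refl ()

bitDistance-triangle : ∀ a b c → bitDistance a c ≤ bitDistance a b + bitDistance b c
bitDistance-triangle false false c     = ≤-reflexive refl
bitDistance-triangle true  true  c     = ≤-reflexive refl
bitDistance-triangle false true  false = z≤n
bitDistance-triangle false true  true  = s≤s z≤n
bitDistance-triangle true  false false = s≤s z≤n
bitDistance-triangle true  false true  = z≤n

hamming-triangle : ∀ {r} (x y z : Fin r → Bool) → hamming x z ≤ hamming x y + hamming y z
hamming-triangle {zero}  x y z = z≤n
hamming-triangle {suc r} x y z = begin
  bitDistance (head x) (head z) + hamming (tail x) (tail z)
    ≤⟨ +-mono-≤ (bitDistance-triangle (head x) (head y) (head z))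
                (hamming-triangle (tail x) (tail y) (tail z)) ⟩
  (bitDistance (head x) (head y) + bitDistance (head y) (head z))
    + (hamming (tail x) (tail y) + hamming (tail y) (tail z))
    ≡⟨ interchange (bitDistance (head x) (head y)) (bitDistance (head y) (head z))
                   (hamming (tail x) (tail y)) (hamming (tail y) (tail z)) ⟩
  hamming x y + hamming y z ∎
  where open ≤-Reasoning

hamming≡0⇒≗ : ∀ {r} (x y : Fin r → Bool) → hamming x y ≡ 0 → x ≗ y
hamming≡0⇒≗ {suc r} x y h i with x fzero ≟ y fzero | i
... | yes x₀≡y₀ | fzero  = x₀≡y₀
... | yes _     | fsuc j = hamming≡0⇒≗ (tail x) (tail y) h j
... | no _      | _      = ⊥-elim (1+n≢0 h)

hamming-cong : ∀ {r} {x x′ y y′ : Fin r → Bool} → x ≗ x′ → y ≗ y′ →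
               hamming x y ≡ hamming x′ y′
hamming-cong {zero}  _    _    = refl
hamming-cong {suc r} x≗x′ y≗y′ =
  cong₂ _+_ (cong₂ bitDistance (x≗x′ fzero) (y≗y′ fzero)) (hamming-cong (x≗x′ ∘ fsuc) (y≗y′ ∘ fsuc))

module _ {r : ℕ} (x y u v : Fin (suc r) → Bool) where

  private
    heads₁ heads₂ tails₁ tails₂ : ℕ
    heads₁ = bitDistance (head x) (head u) + bitDistance (head y) (head v)
    heads₂ = bitDistance (head x) (head v) + bitDistance (head y) (head u)
    tails₁ = hamming (tail x) (tail u) + hamming (tail y) (tail v)
    tails₂ = hamming (tail x) (tail v) + hamming (tail y) (tail u)

    split₁ : hamming x u + hamming y v ≡ heads₁ + tails₁
    split₁ = interchange (bitDistance (head x) (head u)) (hamming (tail x) (tail u))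
                         (bitDistance (head y) (head v)) (hamming (tail y) (tail v))

    split₂ : hamming x v + hamming y u ≡ heads₂ + tails₂
    split₂ = interchange (bitDistance (head x) (head v)) (hamming (tail x) (tail v))
                         (bitDistance (head y) (head u)) (hamming (tail y) (tail u))

  balanced-cons : Balanced bitDistance (head x) (head y) (head u) (head v) →
                  Balanced hamming (tail x) (tail y) (tail u) (tail v) →
                  Balanced hamming x y u v
  balanced-cons heads tails = trans split₁ (trans (cong₂ _+_ heads tails) (sym split₂))

  balanced-tail : Balanced bitDistance (head x) (head y) (head u) (head v) →
                  Balanced hamming x y u v →
                  Balanced hamming (tail x) (tail y) (tail u) (tail v)
  balanced-tail heads bal =
    +-cancelˡ-≡ heads₁ tails₁ tails₂ (trans (sym split₁) (trans bal (trans split₂ (cong (_+ tails₂) (sym heads)))))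

  balanced-head : Balanced hamming (tail x) (tail y) (tail u) (tail v) →
                  Balanced hamming x y u v →
                  Balanced bitDistance (head x) (head y) (head u) (head v)
  balanced-head tails bal =
    +-cancelʳ-≡ tails₁ heads₁ heads₂ (trans (sym split₁) (trans bal (trans split₂ (cong (heads₂ +_) (sym tails)))))

module _ {r : ℕ} {x y u v : Fin r → Bool} where

  balanced-≗ˡ : x ≗ y → Balanced hamming x y u v
  balanced-≗ˡ x≗y = begin
    hamming x u + hamming y v ≡⟨ cong (hamming x u +_) (hamming-cong (sym ∘ x≗y) λ _ → refl) ⟩
    hamming x u + hamming x v ≡⟨ +-comm (hamming x u) (hamming x v) ⟩
    hamming x v + hamming x u ≡⟨ cong (hamming x v +_) (hamming-cong x≗y λ _ → refl) ⟩
    hamming x v + hamming y u ∎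
    where open ≡-Reasoning

  balanced-≗ʳ : u ≗ v → Balanced hamming x y u v
  balanced-≗ʳ u≗v = cong₂ _+_ (hamming-cong (λ _ → refl) u≗v) (hamming-cong (λ _ → refl) (sym ∘ u≗v))

data EdgeView {r : ℕ} (x y : Fin (suc r) → Bool) : Set where
  flips-head : head y ≡ not (head x) → tail x ≗ tail y → EdgeView x y
  flips-tail : head x ≡ head y → hamming (tail x) (tail y) ≡ 1 → EdgeView x y

edgeView : ∀ {r} (x y : Fin (suc r) → Bool) → hamming x y ≡ 1 → EdgeView x y
edgeView x y h with x fzero ≟ y fzero
... | yes x₀≡y₀ = flips-tail x₀≡y₀ h
... | no  x₀≢y₀ = flips-head (¬-not (x₀≢y₀ ∘ sym)) (hamming≡0⇒≗ (tail x) (tail y) (suc-injective h))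

unbalanced-euclidean : ∀ {r} {a b x y u v : Fin r → Bool} →
  hamming a b ≡ 1 → hamming x y ≡ 1 → hamming u v ≡ 1 →
  ¬ Balanced hamming a b x y → ¬ Balanced hamming a b u v → ¬ Balanced hamming x y u v
unbalanced-euclidean {zero} () _ _
unbalanced-euclidean {suc r} {a} {b} {x} {y} {u} {v} hab hxy huv ab∦xy ab∦uv
  with edgeView a b hab | edgeView x y hxy | edgeView u v huv
... | flips-head _ A≗B | flips-tail x₀≡y₀ _ | _ =
  ⊥-elim (ab∦xy (balanced-cons a b x y (balanced-degenerateʳ bitDistance x₀≡y₀ (head a) (head b)) (balanced-≗ˡ A≗B)))
... | flips-head _ A≗B | _ | flips-tail u₀≡v₀ _ =
  ⊥-elim (ab∦uv (balanced-cons a b u v (balanced-degenerateʳ bitDistance u₀≡v₀ (head a) (head b)) (balanced-≗ˡ A≗B)))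
... | flips-tail a₀≡b₀ _ | flips-head _ X≗Y | _ =
  ⊥-elim (ab∦xy (balanced-cons a b x y (balanced-degenerateˡ bitDistance a₀≡b₀ (head x) (head y)) (balanced-≗ʳ X≗Y)))
... | flips-tail a₀≡b₀ _ | _ | flips-head _ U≗V =
  ⊥-elim (ab∦uv (balanced-cons a b u v (balanced-degenerateˡ bitDistance a₀≡b₀ (head u) (head v)) (balanced-≗ʳ U≗V)))
... | flips-head _ _ | flips-head y₀≡¬x₀ X≗Y | flips-head v₀≡¬u₀ _ =
  unbalanced-bits y₀≡¬x₀ v₀≡¬u₀ ∘ balanced-head x y u v (balanced-≗ˡ X≗Y)
... | flips-tail a₀≡b₀ hAB | flips-tail x₀≡y₀ hXY | flips-tail _ hUV =
  unbalanced-euclidean {r} hAB hXY hUV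
    (ab∦xy ∘ balanced-cons a b x y (balanced-degenerateˡ bitDistance a₀≡b₀ (head x) (head y)))
    (ab∦uv ∘ balanced-cons a b u v (balanced-degenerateˡ bitDistance a₀≡b₀ (head u) (head v)))
  ∘ balanced-tail x y u v (balanced-degenerateˡ bitDistance x₀≡y₀ (head u) (head v))

module _ {n : ℕ} {G : Graph n} {d : Fin n → Fin n → ℕ} (d-isDistance : IsDistance G d) where
  open Graph G using (Adj; irrefl)

  distance-self : ∀ x → d x x ≡ 0
  distance-self x = n≤0⇒n≡0 (proj₂ (d-isDistance x x) constant refl refl)
    where
    constant : Walk G
    constant = record { len = 0 ; vtx = λ _ → x ; step = λ () }

  distance≡0⇒≡ : ∀ {x y} → d x y ≡ 0 → x ≡ y
  distance≡0⇒≡ {x} {y} d≡0 with proj₁ (d-isDistance x y)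
  ... | w , refl , refl , len≡d = start≡end w (trans len≡d d≡0)
    where
    start≡end : (w : Walk G) → len w ≡ 0 → start w ≡ end w
    start≡end record { len = zero } refl = refl

  distance-adjacent : ∀ {x y} → Adj x y → d x y ≡ 1
  distance-adjacent {x} {y} x~y =
    ≤-antisym (proj₂ (d-isDistance x y) edge refl refl)
              (n≢0⇒n>0 λ d≡0 → irrefl (subst (Adj x) (sym (distance≡0⇒≡ d≡0)) x~y))
    where
    edge : Walk G
    edge = record { len = 1 ; vtx = λ { fzero → x ; (fsuc _) → y } ; step = λ { fzero → x~y } }

fromℕ-capped : ∀ {L} → ℕ → Fin (suc L)
fromℕ-capped zero            = fzero
fromℕ-capped {zero}  (suc m) = fzero
fromℕ-capped {suc L} (suc m) = fsuc (fromℕ-capped m)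

fromℕ-capped-toℕ : ∀ {L} (i : Fin L) → fromℕ-capped (toℕ i) ≡ inject₁ i
fromℕ-capped-toℕ fzero    = refl
fromℕ-capped-toℕ (fsuc i) = cong fsuc (fromℕ-capped-toℕ i)

fromℕ-capped-suc-toℕ : ∀ {L} (i : Fin L) → fromℕ-capped (suc (toℕ i)) ≡ fsuc i
fromℕ-capped-suc-toℕ fzero    = refl
fromℕ-capped-suc-toℕ (fsuc i) = cong fsuc (fromℕ-capped-suc-toℕ i)

fromℕ-capped-top : ∀ L → fromℕ-capped L ≡ fromℕ L
fromℕ-capped-top zero    = refl
fromℕ-capped-top (suc L) = cong fsuc (fromℕ-capped-top L)

module Geodesic {n : ℕ} {G : Graph n} {d : Fin n → Fin n → ℕ}
  (d-isDistance : IsDistance G d) (d-triangle : ∀ x y z → d x z ≤ d x y + d y z)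
  (w : Walk G) (w-geodesic : IsGeodesic G d w) where
  open Graph G using (Adj)

  private
    L : ℕ
    L = len w

    vertex : ℕ → Fin n
    vertex m = vtx w (fromℕ-capped m)

    vertex-adjacent : ∀ {m} → m < L → Adj (vertex m) (vertex (suc m))
    vertex-adjacent m<L =
      subst (λ m → Adj (vertex m) (vertex (suc m))) (toℕ-fromℕ< m<L)
        (subst₂ Adj (cong (vtx w) (sym (fromℕ-capped-toℕ i))) (cong (vtx w) (sym (fromℕ-capped-suc-toℕ i)))
          (step w i))
      where i = fromℕ< m<L

    segment-≤ : ∀ p k → p + k ≤ L → d (vertex p) (vertex (p + k)) ≤ k
    segment-≤ p zero _ rewrite +-identityʳ p = ≤-reflexive (distance-self d-isDistance (vertex p))
    segment-≤ p (suc k) p+k<L rewrite +-suc p k = begin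
      d (vertex p) (vertex (suc (p + k)))
        ≤⟨ d-triangle (vertex p) (vertex (p + k)) (vertex (suc (p + k))) ⟩
      d (vertex p) (vertex (p + k)) + d (vertex (p + k)) (vertex (suc (p + k)))
        ≤⟨ +-mono-≤ (segment-≤ p k (<⇒≤ p+k<L))
                    (≤-reflexive (distance-adjacent d-isDistance (vertex-adjacent p+k<L))) ⟩
      k + 1
        ≡⟨ +-comm k 1 ⟩
      suc k ∎
      where open ≤-Reasoning

    segment : ∀ {p k q m} → p + k ≡ q → q + m ≡ L → d (vertex p) (vertex q) ≡ k
    segment {p} {k} {q} {m} p+k≡q q+m≡L = ≤-antisym upper lower
      where
      p+k+m≡L : p + k + m ≡ L
      p+k+m≡L = trans (cong (_+ m) p+k≡q) q+m≡L

      upper : d (vertex p) (vertex q) ≤ k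
      upper = subst (λ q → d (vertex p) (vertex q) ≤ k) p+k≡q
                (segment-≤ p k (subst (p + k ≤_) p+k+m≡L (m≤m+n (p + k) m)))

      q-to-end : d (vertex q) (vertex L) ≤ m
      q-to-end = subst (λ l → d (vertex q) (vertex l) ≤ m) q+m≡L (segment-≤ q m (≤-reflexive q+m≡L))

      lower : k ≤ d (vertex p) (vertex q)
      lower = +-cancelʳ-≤ m k _ (+-cancelˡ-≤ p (k + m) _ (begin
        p + (k + m)
          ≡⟨ trans (sym (+-assoc p k m)) p+k+m≡L ⟩
        L
          ≡⟨ trans w-geodesic (cong (d (vertex 0) ∘ vtx w) (sym (fromℕ-capped-top L))) ⟩
        d (vertex 0) (vertex L)
          ≤⟨ d-triangle (vertex 0) (vertex p) (vertex L) ⟩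
        d (vertex 0) (vertex p) + d (vertex p) (vertex L)
          ≤⟨ +-mono-≤ (segment-≤ 0 p (subst (p ≤_) p+k+m≡L (≤-trans (m≤m+n p k) (m≤m+n (p + k) m))))
                      (d-triangle (vertex p) (vertex q) (vertex L)) ⟩
        p + (d (vertex p) (vertex q) + d (vertex q) (vertex L))
          ≤⟨ +-monoʳ-≤ p (+-monoʳ-≤ (d (vertex p) (vertex q)) q-to-end) ⟩
        p + (d (vertex p) (vertex q) + m) ∎))
        where open ≤-Reasoning

    vertices-balanced : ∀ {p q} → p < q → q < L →
                        Balanced d (vertex p) (vertex (suc p)) (vertex q) (vertex (suc q))
    vertices-balanced {p} {q} p<q q<L with m≤n⇒∃[o]m+o≡n p<q | m≤n⇒∃[o]m+o≡n q<L
    ... | t , 1+p+t≡q | m , 1+q+m≡L = begin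
      d (vertex p) (vertex q) + d (vertex (suc p)) (vertex (suc q))
        ≡⟨ cong₂ _+_ (segment p+[1+t]≡q q+[1+m]≡L) (segment (cong suc p+[1+t]≡q) 1+q+m≡L) ⟩
      suc t + suc t
        ≡⟨ cong suc (+-suc t t) ⟩
      suc (suc t) + t
        ≡⟨ cong₂ _+_ (sym (segment (trans (+-suc p (suc t)) (cong suc p+[1+t]≡q)) 1+q+m≡L))
                     (sym (segment 1+p+t≡q q+[1+m]≡L)) ⟩
      d (vertex p) (vertex (suc q)) + d (vertex (suc p)) (vertex q) ∎
      where
      open ≡-Reasoning
      p+[1+t]≡q : p + suc t ≡ q
      p+[1+t]≡q = trans (+-suc p t) 1+p+t≡q
      q+[1+m]≡L : q + suc m ≡ L
      q+[1+m]≡L = trans (+-suc q m) 1+q+m≡L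

  edges-balanced : ∀ {i j : Fin (len w)} → toℕ i < toℕ j →
    Balanced d (vtx w (inject₁ i)) (vtx w (fsuc i)) (vtx w (inject₁ j)) (vtx w (fsuc j))
  edges-balanced {i} {j} i<j
    rewrite sym (fromℕ-capped-toℕ i) | sym (fromℕ-capped-suc-toℕ i)
          | sym (fromℕ-capped-toℕ j) | sym (fromℕ-capped-suc-toℕ j)
    = vertices-balanced i<j (toℕ<n j)

module PartialCube {n : ℕ} {G : Graph n} {d : Fin n → Fin n → ℕ} (d-isDistance : IsDistance G d)
  {r : ℕ} (f : Fin n → Fin r → Bool) (f-isometric : ∀ x y → hamming (f x) (f y) ≡ d x y) where
  open Graph G using (Adj)

  private
    d-triangle : ∀ x y z → d x z ≤ d x y + d y z
    d-triangle x y z =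
      subst₂ _≤_ (f-isometric x z) (cong₂ _+_ (f-isometric x y) (f-isometric y z))
        (hamming-triangle (f x) (f y) (f z))

    image-edge : ∀ {x y} → Adj x y → hamming (f x) (f y) ≡ 1
    image-edge {x} {y} x~y = trans (f-isometric x y) (distance-adjacent d-isDistance x~y)

  Θ-euclidean : ∀ {a b x y u v} → Adj a b → Adj x y → Adj u v →
            Θ d a b x y → Θ d a b u v → Θ d x y u v
  Θ-euclidean a~b x~y u~v ab∦xy ab∦uv =
    unbalanced-euclidean {r} (image-edge a~b) (image-edge x~y) (image-edge u~v)
      (ab∦xy ∘ balanced-resp f-isometric) (ab∦uv ∘ balanced-resp f-isometric)
    ∘ balanced-resp (λ a b → sym (f-isometric a b))

  ΘClass-geodesic-unique : (w : Walk G) → IsGeodesic G d w → ∀ {a b} → Adj a b →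
    ∀ {i j : Fin (len w)} → toℕ i < toℕ j →
    ΘClass G d a b (vtx w (inject₁ i)) (vtx w (fsuc i)) →
    ¬ ΘClass G d a b (vtx w (inject₁ j)) (vtx w (fsuc j))
  ΘClass-geodesic-unique w w-geodesic a~b i<j (x~y , ab∦xy) (u~v , ab∦uv) =
    Θ-euclidean a~b x~y u~v ab∦xy ab∦uv (Geodesic.edges-balanced d-isDistance d-triangle w w-geodesic i<j)

pigeonhole-⊎ : ∀ {I : Set} {_≺_ : I → I → Set} {P Q : I → Set} → Transitive _≺_ →
  (∀ {i j} → i ≺ j → P i → ¬ P j) → (∀ {i j} → i ≺ j → Q i → ¬ Q j) →
  ∀ {i j k} → i ≺ j → j ≺ k → P i ⊎ Q i → P j ⊎ Q j → P k ⊎ Q k → ⊥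
pigeonhole-⊎ ≺-trans P-once Q-once i≺j j≺k = λ
  { (inj₁ pᵢ) (inj₁ pⱼ) _         → P-once i≺j pᵢ pⱼ
  ; (inj₂ qᵢ) (inj₂ qⱼ) _         → Q-once i≺j qᵢ qⱼ
  ; (inj₁ pᵢ) (inj₂ _)  (inj₁ pₖ) → P-once (≺-trans i≺j j≺k) pᵢ pₖ
  ; (inj₂ qᵢ) (inj₁ _)  (inj₂ qₖ) → Q-once (≺-trans i≺j j≺k) qᵢ qₖ
  ; (inj₁ _)  (inj₂ qⱼ) (inj₂ qₖ) → Q-once j≺k qⱼ qₖ
  ; (inj₂ _)  (inj₁ pⱼ) (inj₁ pₖ) → P-once j≺k pⱼ pₖ
  }

lemma3p1 : ∀ {n} (G : Graph n) (d : Fin n → Fin n → ℕ) →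
    IsDistance G d → IsPartialCube d →
    ∀ (a b c e : Fin n) → Graph.Adj G a b → Graph.Adj G c e →
    IsEdgeGeneralPosition G d (_∪E_ {G = G} (ΘClass G d a b) (ΘClass G d c e))
lemma3p1 G d d-isDistance (r , f , f-isometric) a b c e a~b c~e w w-geodesic i j k i<j j<k (s₁ , s₂ , s₃) =
  pigeonhole-⊎ {_≺_ = λ i j → toℕ i < toℕ j} <-trans
    (ΘClass-geodesic-unique w w-geodesic a~b) (ΘClass-geodesic-unique w w-geodesic c~e) i<j j<k s₁ s₂ s₃
  where open PartialCube d-isDistance f f-isometric
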